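{- For any delta operator $Q$ there exists a unique linear operator $Q^{ -1}$ on $\mathbb K[x]$ such that $QQ^{ -1}=1$ and $Q^{ -1}Q=1-\mathcal E$. Moreover, if $(s_n)_{n\in\mathbb N}$ is a Sheffer set for $Q$, then for all $n\in\mathbb N$ \[ Q^{ -1}s_n(x)=\frac{s_{n+1}(x)-s_{n+1}(0)}{n+1}. \]
   Context: $\mathbb K$ is a field of characteristic zero; operators are linear maps on $\mathbb K[x]$, $1$ is the identity, $D=d/dx$. A delta operator is an operator $Q$ commuting with all shifts $f(x)\mapsto f(x+a)$ ($a\in\mathbb K$) with $Qx$ a nonzero constant. $\mathcal E$ is the operator sending $f$ to the constant polynomial $f(0)$. A Sheffer set for $Q$ is a sequence of polynomials $(s_n)$ with $\deg s_n=n$ and $Qs_n=ns_{n-1}$ for all $n$ (with $s_{ -1}=0$). -}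

module Defs where

open import Level using (Level; _⊔_; suc)
open import Algebra.Bundles using (CommutativeRing)
open import Data.Nat as ℕ using (ℕ; zero; _<_)
import Data.Nat as N
open import Data.List using (List; []; _∷_; map)
open import Data.Product using (Σ; _×_)
open import Relation.Nullary using (¬_)

record Field (c ℓ : Level) : Set (Level.suc (c ⊔ ℓ)) where
  field
    commutativeRing : CommutativeRing c ℓ
  open CommutativeRing commutativeRing public
  field
    1≉0     : ¬ (1# ≈ 0#)
    inv     : (x : Carrier) → ¬ (x ≈ 0#) → Carrier
    inv-inv : (x : Carrier) (nz : ¬ (x ≈ 0#)) → x * inv x nz ≈ 1#

  ι : ℕ → Carrier
  ι zero    = 0#
  ι (N.suc n) = 1# + ι n

record CharZeroField (c ℓ : Level) : Set (Level.suc (c ⊔ ℓ)) where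
  field
    field′   : Field c ℓ
  open Field field′ public
  field
    charZero : (n : ℕ) → ¬ (ι (N.suc n) ≈ 0#)

module Polynomials {c ℓ : Level} (𝕂 : CharZeroField c ℓ) where
  open CharZeroField 𝕂 using (Carrier; _≈_; _+_; _*_; -_; 0#; 1#; ι)

  -- A polynomial is its list of coefficients [a₀, a₁, …]; two lists denote
  -- the same polynomial iff all coefficients agree (trailing zeros ignored).
  Poly : Set c
  Poly = List Carrier

  coeff : Poly → ℕ → Carrier
  coeff []       _         = 0#
  coeff (a ∷ _)  zero      = a
  coeff (_ ∷ p)  (N.suc i) = coeff p i

  _≋_ : Poly → Poly → Set ℓ
  p ≋ q = (i : ℕ) → coeff p i ≈ coeff q i

  infix 4 _≋_ _≐_

  const : Carrier → Poly
  const a = a ∷ []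

  X : Poly
  X = 0# ∷ 1# ∷ []

  zeroP : Poly
  zeroP = []

  _⊕_ : Poly → Poly → Poly
  []      ⊕ q       = q
  (a ∷ p) ⊕ []      = a ∷ p
  (a ∷ p) ⊕ (b ∷ q) = (a + b) ∷ (p ⊕ q)

  scale : Carrier → Poly → Poly
  scale a p = map (a *_) p

  negP : Poly → Poly
  negP p = map (-_) p

  _⊖_ : Poly → Poly → Poly
  p ⊖ q = p ⊕ negP q

  _⊗_ : Poly → Poly → Poly
  []      ⊗ q = []
  (a ∷ p) ⊗ q = scale a q ⊕ (0# ∷ (p ⊗ q))

  compose : Poly → Poly → Poly
  compose []      q = []
  compose (a ∷ p) q = const a ⊕ (q ⊗ compose p q)

  eval : Poly → Carrier → Carrier
  eval []      a = 0#
  eval (b ∷ p) a = b + a * eval p a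

  shift : Carrier → Poly → Poly
  shift a p = compose p (a ∷ 1# ∷ [])

  Op : Set c
  Op = Poly → Poly

  _≐_ : Op → Op → Set (c ⊔ ℓ)
  S ≐ T = (p : Poly) → S p ≋ T p

  idOp : Op
  idOp p = p

  _∘ₒ_ : Op → Op → Op
  (S ∘ₒ T) p = S (T p)

  ℰ : Op
  ℰ p = const (eval p 0#)

  1-ℰ : Op
  1-ℰ p = p ⊖ ℰ p

  record IsLinear (T : Op) : Set (c ⊔ ℓ) where
    field
      respects : (p q : Poly) → p ≋ q → T p ≋ T q
      additive : (p q : Poly) → T (p ⊕ q) ≋ T p ⊕ T q
      homog    : (a : Carrier) (p : Poly) → T (scale a p) ≋ scale a (T p)

  record IsDelta (Q : Op) : Set (c ⊔ ℓ) where
    field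
      linear     : IsLinear Q
      shiftInv   : (a : Carrier) (p : Poly) → Q (shift a p) ≋ shift a (Q p)
      constX     : Carrier
      constX≉0   : ¬ (constX ≈ 0#)
      QX≋const   : Q X ≋ const constX

  HasDegree : Poly → ℕ → Set ℓ
  HasDegree p n = (¬ (coeff p n ≈ 0#)) × ((i : ℕ) → n < i → coeff p i ≈ 0#)

  record IsSheffer (Q : Op) (s : ℕ → Poly) : Set ℓ where
    field
      degree : (n : ℕ) → HasDegree (s n) n
      Q-s0   : Q (s zero) ≋ zeroP
      Q-ssuc : (n : ℕ) → Q (s (N.suc n)) ≋ scale (ι (N.suc n)) (s n)

{-# OPTIONS --safe #-}
module Submission where

-- Shift invariance makes Q commute with the forward difference Δ f = f(x+1) − f(x),
-- which maps a polynomial of degree m+1 with leading coefficient a to one of degree m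
-- with leading coefficient (m+1)·a. Since Δ x = 1 and Δ (Q x) = 0, Q kills constants;
-- then induction on the degree shows that Q sends degree m+1 with leading coefficient a
-- to degree m with leading coefficient c·(m+1)·a, where c = Q x ≠ 0. So Q is onto with
-- kernel the constants, and Q⁻¹ p is the unique preimage of p vanishing at 0. Every
-- claim follows by checking that both sides have the same image under Q and the same
-- value at 0.

open import Defs
open import Level using (Level)
open import Data.Nat using (ℕ; suc)
open import Data.Product using (Σ; _×_)

import Data.Nat as ℕ
open import Data.Nat using (zero; pred; _≤_; z≤n; s≤s)
open import Data.Nat.Properties using (≤-refl; ≤-trans; n≤1+n; m≤m+n; m≤n+m; m≤n⇒m<n∨m≡n; pred-mono-≤)
open import Data.List using ([]; _∷_; length)
open import Data.Product using (_,_)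
open import Data.Sum using (inj₁; inj₂)
open import Relation.Nullary using (¬_)
import Relation.Binary.PropositionalEquality as ≡

module FieldProperties {c ℓ : Level} (F : Field c ℓ) where
  open Field F
  open import Relation.Binary.Reasoning.Setoid setoid

  ι-1 : ι 1 ≈ 1#
  ι-1 = +-identityʳ 1#

  inv-*-cancel : ∀ x (x≉0 : ¬ x ≈ 0#) y → inv x x≉0 * (x * y) ≈ y
  inv-*-cancel x x≉0 y = begin
    inv x x≉0 * (x * y)  ≈⟨ *-assoc _ x y ⟨
    inv x x≉0 * x * y    ≈⟨ *-congʳ (*-comm _ x) ⟩
    x * inv x x≉0 * y    ≈⟨ *-congʳ (inv-inv x x≉0) ⟩
    1# * y               ≈⟨ *-identityˡ y ⟩
    y                    ∎

  *-inv-cancel : ∀ x (x≉0 : ¬ x ≈ 0#) y → x * (inv x x≉0 * y) ≈ y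
  *-inv-cancel x x≉0 y = begin
    x * (inv x x≉0 * y)  ≈⟨ *-assoc x _ y ⟨
    x * inv x x≉0 * y    ≈⟨ *-congʳ (inv-inv x x≉0) ⟩
    1# * y               ≈⟨ *-identityˡ y ⟩
    y                    ∎

  *-cancelˡ : ∀ {x y z} → ¬ x ≈ 0# → x * y ≈ x * z → y ≈ z
  *-cancelˡ {x} {y} {z} x≉0 xy≈xz = begin
    y                    ≈⟨ inv-*-cancel x x≉0 y ⟨
    inv x x≉0 * (x * y)  ≈⟨ *-congˡ xy≈xz ⟩
    inv x x≉0 * (x * z)  ≈⟨ inv-*-cancel x x≉0 z ⟩
    z                    ∎

  xy≈0⇒y≈0 : ∀ {x y} → ¬ x ≈ 0# → x * y ≈ 0# → y ≈ 0#
  xy≈0⇒y≈0 {x} x≉0 xy≈0 = *-cancelˡ x≉0 (trans xy≈0 (sym (zeroʳ x)))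

module PolynomialProperties {c ℓ : Level} (𝕂 : CharZeroField c ℓ) where
  open CharZeroField 𝕂
  open Polynomials 𝕂
  open FieldProperties field′ using (ι-1; xy≈0⇒y≈0)
  open import Algebra.Properties.Ring ring using (-0#≈0#; -1*x≈-x; xyx⁻¹≈y; x≈y⇒x∙y⁻¹≈ε)
  open import Relation.Binary.Reasoning.Setoid setoid

  coeff-⊕ : ∀ p q i → coeff (p ⊕ q) i ≈ coeff p i + coeff q i
  coeff-⊕ []      q       i       = sym (+-identityˡ _)
  coeff-⊕ (a ∷ p) []      i       = sym (+-identityʳ _)
  coeff-⊕ (a ∷ p) (b ∷ q) zero    = refl
  coeff-⊕ (a ∷ p) (b ∷ q) (suc i) = coeff-⊕ p q i

  coeff-scale : ∀ a p i → coeff (scale a p) i ≈ a * coeff p i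
  coeff-scale a []      i       = sym (zeroʳ a)
  coeff-scale a (b ∷ p) zero    = refl
  coeff-scale a (b ∷ p) (suc i) = coeff-scale a p i

  coeff-negP : ∀ p i → coeff (negP p) i ≈ - coeff p i
  coeff-negP []      i       = sym -0#≈0#
  coeff-negP (b ∷ p) zero    = refl
  coeff-negP (b ∷ p) (suc i) = coeff-negP p i

  coeff-⊖ : ∀ p q i → coeff (p ⊖ q) i ≈ coeff p i - coeff q i
  coeff-⊖ p q i = trans (coeff-⊕ p (negP q) i) (+-congˡ (coeff-negP q i))

  negP≋scale-1 : ∀ p → negP p ≋ scale (- 1#) p
  negP≋scale-1 p i = begin
    coeff (negP p) i         ≈⟨ coeff-negP p i ⟩
    - coeff p i              ≈⟨ -1*x≈-x _ ⟨
    - 1# * coeff p i         ≈⟨ coeff-scale (- 1#) p i ⟨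
    coeff (scale (- 1#) p) i ∎

  eval-0 : ∀ p → eval p 0# ≈ coeff p 0
  eval-0 []      = refl
  eval-0 (b ∷ p) = trans (+-congˡ (zeroˡ _)) (+-identityʳ b)

  coeff₀-1-ℰ : ∀ p → coeff (1-ℰ p) 0 ≈ 0#
  coeff₀-1-ℰ p = trans (coeff-⊖ p (ℰ p) 0) (x≈y⇒x∙y⁻¹≈ε (sym (eval-0 p)))

  DegreeBelow : Poly → ℕ → Set ℓ
  DegreeBelow p m = ∀ i → m ≤ i → coeff p i ≈ 0#

  degreeBelow-length : ∀ p → DegreeBelow p (length p)
  degreeBelow-length []      i       _       = refl
  degreeBelow-length (a ∷ p) (suc i) (s≤s h) = degreeBelow-length p i h

  degreeBelow-mono : ∀ p {m n} → m ≤ n → DegreeBelow p m → DegreeBelow p n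
  degreeBelow-mono p m≤n B i n≤i = B i (≤-trans m≤n n≤i)

  degreeBelow-tail : ∀ {a p m} → DegreeBelow (a ∷ p) m → DegreeBelow p (pred m)
  degreeBelow-tail {m = zero}  B i _ = B (suc i) z≤n
  degreeBelow-tail {m = suc m} B i h = B (suc i) (s≤s h)

  degreeBelow-lower : ∀ p {m} → DegreeBelow p (suc m) → coeff p m ≈ 0# → DegreeBelow p m
  degreeBelow-lower p B pₘ≈0 i m≤i with m≤n⇒m<n∨m≡n m≤i
  ... | inj₁ m<i    = B i m<i
  ... | inj₂ ≡.refl = pₘ≈0

  degreeBelow-descend : ∀ p {m} → (∀ n → m ≤ n → DegreeBelow p (suc n) → coeff p n ≈ 0#) →
                        DegreeBelow p m
  degreeBelow-descend p {m} top≈0 =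
    from (length p) (degreeBelow-mono p (m≤m+n (length p) m) (degreeBelow-length p))
    where
    from : ∀ k → DegreeBelow p (k ℕ.+ m) → DegreeBelow p m
    from zero    B = B
    from (suc k) B = from k (degreeBelow-lower p B (top≈0 (k ℕ.+ m) (m≤n+m m k) B))

  degreeBelow-⊖ : ∀ p q {m} → DegreeBelow p m → DegreeBelow q m → DegreeBelow (p ⊖ q) m
  degreeBelow-⊖ p q Bp Bq i h =
    trans (coeff-⊖ p q i) (x≈y⇒x∙y⁻¹≈ε (trans (Bp i h) (sym (Bq i h))))

  const-degreeBelow-1 : ∀ a → DegreeBelow (const a) 1
  const-degreeBelow-1 a (suc i) _ = refl

  X-degreeBelow-2 : DegreeBelow X 2
  X-degreeBelow-2 (suc zero)    (s≤s ())
  X-degreeBelow-2 (suc (suc i)) _ = refl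

  degreeBelow-1⇒≋scale-1 : ∀ p → DegreeBelow p 1 → p ≋ scale (coeff p 0) (const 1#)
  degreeBelow-1⇒≋scale-1 p B zero    = sym (*-identityʳ _)
  degreeBelow-1⇒≋scale-1 p B (suc i) = B (suc i) (s≤s z≤n)

  degreeBelow-2⇒≋affine : ∀ p → DegreeBelow p 2 → p ≋ const (coeff p 0) ⊕ scale (coeff p 1) X
  degreeBelow-2⇒≋affine p B zero          = sym (trans (+-congˡ (zeroʳ _)) (+-identityʳ _))
  degreeBelow-2⇒≋affine p B (suc zero)    = sym (*-identityʳ _)
  degreeBelow-2⇒≋affine p B (suc (suc i)) = B (suc (suc i)) (s≤s (s≤s z≤n))

  monomial : Carrier → ℕ → Poly
  monomial a zero    = const a
  monomial a (suc k) = 0# ∷ monomial a k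

  coeff-monomial : ∀ a k → coeff (monomial a k) k ≈ a
  coeff-monomial a zero    = refl
  coeff-monomial a (suc k) = coeff-monomial a k

  monomial-degreeBelow : ∀ a k → DegreeBelow (monomial a k) (suc k)
  monomial-degreeBelow a zero    (suc i) _       = refl
  monomial-degreeBelow a (suc k) (suc i) (s≤s h) = monomial-degreeBelow a k i h

  module Linear {T : Op} (lin : IsLinear T) where
    open IsLinear lin

    linear-⊕ : ∀ p q i → coeff (T (p ⊕ q)) i ≈ coeff (T p) i + coeff (T q) i
    linear-⊕ p q i = trans (additive p q i) (coeff-⊕ (T p) (T q) i)

    linear-scale : ∀ a p i → coeff (T (scale a p)) i ≈ a * coeff (T p) i
    linear-scale a p i = trans (homog a p i) (coeff-scale a (T p) i)

    linear-negP : ∀ p i → coeff (T (negP p)) i ≈ - coeff (T p) i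
    linear-negP p i = begin
      coeff (T (negP p)) i          ≈⟨ respects (negP p) (scale (- 1#) p) (negP≋scale-1 p) i ⟩
      coeff (T (scale (- 1#) p)) i  ≈⟨ linear-scale (- 1#) p i ⟩
      - 1# * coeff (T p) i          ≈⟨ -1*x≈-x _ ⟩
      - coeff (T p) i               ∎

    linear-⊖ : ∀ p q i → coeff (T (p ⊖ q)) i ≈ coeff (T p) i - coeff (T q) i
    linear-⊖ p q i = trans (linear-⊕ p (negP q) i) (+-congˡ (linear-negP q i))

    -- zeroP is literally scale 0# zeroP.
    linear-zeroP : DegreeBelow (T zeroP) 0
    linear-zeroP i _ = trans (linear-scale 0# zeroP i) (zeroˡ _)

  1+X : Poly
  1+X = 1# ∷ 1# ∷ []

  shift₁ : Op
  shift₁ = shift 1#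

  coeff-const⊗ : ∀ a t i → coeff (const a ⊗ t) i ≈ a * coeff t i
  coeff-const⊗ a t zero    =
    trans (coeff-⊕ (scale a t) (const 0#) 0) (trans (+-identityʳ _) (coeff-scale a t 0))
  coeff-const⊗ a t (suc i) =
    trans (coeff-⊕ (scale a t) (const 0#) (suc i)) (trans (+-identityʳ _) (coeff-scale a t (suc i)))

  coeff₀-1+X⊗ : ∀ t → coeff (1+X ⊗ t) 0 ≈ coeff t 0
  coeff₀-1+X⊗ t = begin
    coeff (1+X ⊗ t) 0          ≈⟨ coeff-⊕ (scale 1# t) (0# ∷ const 1# ⊗ t) 0 ⟩
    coeff (scale 1# t) 0 + 0#  ≈⟨ +-identityʳ _ ⟩
    coeff (scale 1# t) 0       ≈⟨ coeff-scale 1# t 0 ⟩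
    1# * coeff t 0             ≈⟨ *-identityˡ _ ⟩
    coeff t 0                  ∎

  coeffₛ-1+X⊗ : ∀ t i → coeff (1+X ⊗ t) (suc i) ≈ coeff t (suc i) + coeff t i
  coeffₛ-1+X⊗ t i = begin
    coeff (1+X ⊗ t) (suc i)
      ≈⟨ coeff-⊕ (scale 1# t) (0# ∷ const 1# ⊗ t) (suc i) ⟩
    coeff (scale 1# t) (suc i) + coeff (const 1# ⊗ t) i
      ≈⟨ +-cong (coeff-scale 1# t (suc i)) (coeff-const⊗ 1# t i) ⟩
    1# * coeff t (suc i) + 1# * coeff t i
      ≈⟨ +-cong (*-identityˡ _) (*-identityˡ _) ⟩
    coeff t (suc i) + coeff t i
      ∎

  coeff₀-shift₁ : ∀ a r → coeff (shift₁ (a ∷ r)) 0 ≈ a + coeff (shift₁ r) 0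
  coeff₀-shift₁ a r = trans (coeff-⊕ (const a) (1+X ⊗ shift₁ r) 0) (+-congˡ (coeff₀-1+X⊗ (shift₁ r)))

  coeffₛ-shift₁ : ∀ a r i →
                  coeff (shift₁ (a ∷ r)) (suc i) ≈ coeff (shift₁ r) (suc i) + coeff (shift₁ r) i
  coeffₛ-shift₁ a r i =
    trans (coeff-⊕ (const a) (1+X ⊗ shift₁ r) (suc i)) (trans (+-identityˡ _) (coeffₛ-1+X⊗ (shift₁ r) i))

  shift₁-degreeBelow : ∀ r {m} → DegreeBelow r m → DegreeBelow (shift₁ r) m
  shift₁-degreeBelow []      B i h = refl
  shift₁-degreeBelow (a ∷ r) {m} B = cons-degreeBelow
    where
    tail-degreeBelow : DegreeBelow (shift₁ r) (pred m)
    tail-degreeBelow = shift₁-degreeBelow r (degreeBelow-tail B)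

    cons-degreeBelow : DegreeBelow (shift₁ (a ∷ r)) m
    cons-degreeBelow zero    m≤0 = begin
      coeff (shift₁ (a ∷ r)) 0  ≈⟨ coeff₀-shift₁ a r ⟩
      a + coeff (shift₁ r) 0    ≈⟨ +-cong (B 0 m≤0) (tail-degreeBelow 0 (pred-mono-≤ m≤0)) ⟩
      0# + 0#                   ≈⟨ +-identityʳ 0# ⟩
      0#                        ∎
    cons-degreeBelow (suc i) m≤1+i = begin
      coeff (shift₁ (a ∷ r)) (suc i)                  ≈⟨ coeffₛ-shift₁ a r i ⟩
      coeff (shift₁ r) (suc i) + coeff (shift₁ r) i   ≈⟨ +-cong (tail-degreeBelow (suc i) (≤-trans m-1≤i (n≤1+n i)))
                                                                (tail-degreeBelow i m-1≤i) ⟩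
      0# + 0#                                         ≈⟨ +-identityʳ 0# ⟩
      0#                                              ∎
      where
      m-1≤i : pred m ≤ i
      m-1≤i = pred-mono-≤ m≤1+i

  shift₁-leading : ∀ r m → DegreeBelow r (suc m) → coeff (shift₁ r) m ≈ coeff r m
  shift₁-leading []      m       B = refl
  shift₁-leading (a ∷ r) zero    B = begin
    coeff (shift₁ (a ∷ r)) 0  ≈⟨ coeff₀-shift₁ a r ⟩
    a + coeff (shift₁ r) 0    ≈⟨ +-congˡ (shift₁-degreeBelow r (degreeBelow-tail B) 0 z≤n) ⟩
    a + 0#                    ≈⟨ +-identityʳ a ⟩
    a                         ∎
  shift₁-leading (a ∷ r) (suc m) B = begin
    coeff (shift₁ (a ∷ r)) (suc m)                 ≈⟨ coeffₛ-shift₁ a r m ⟩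
    coeff (shift₁ r) (suc m) + coeff (shift₁ r) m  ≈⟨ +-cong (shift₁-degreeBelow r (degreeBelow-tail B) (suc m) ≤-refl)
                                                             (shift₁-leading r m (degreeBelow-tail B)) ⟩
    0# + coeff r m                                 ≈⟨ +-identityˡ _ ⟩
    coeff r m                                      ∎

  Δ : Op
  Δ r = shift₁ r ⊖ r

  coeff₀-Δ : ∀ a r → coeff (Δ (a ∷ r)) 0 ≈ coeff (shift₁ r) 0
  coeff₀-Δ a r = trans (coeff-⊖ (shift₁ (a ∷ r)) (a ∷ r) 0) (trans (+-congʳ (coeff₀-shift₁ a r)) (xyx⁻¹≈y a _))

  coeffₛ-Δ : ∀ a r i → coeff (Δ (a ∷ r)) (suc i) ≈ coeff (shift₁ r) (suc i) + coeff (Δ r) i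
  coeffₛ-Δ a r i = begin
    coeff (Δ (a ∷ r)) (suc i)
      ≈⟨ coeff-⊖ (shift₁ (a ∷ r)) (a ∷ r) (suc i) ⟩
    coeff (shift₁ (a ∷ r)) (suc i) - coeff r i
      ≈⟨ +-congʳ (coeffₛ-shift₁ a r i) ⟩
    coeff (shift₁ r) (suc i) + coeff (shift₁ r) i - coeff r i
      ≈⟨ +-assoc _ _ _ ⟩
    coeff (shift₁ r) (suc i) + (coeff (shift₁ r) i - coeff r i)
      ≈⟨ +-congˡ (coeff-⊖ (shift₁ r) r i) ⟨
    coeff (shift₁ r) (suc i) + coeff (Δ r) i
      ∎

  Δ-degreeBelow : ∀ r m → DegreeBelow r (suc m) → DegreeBelow (Δ r) m
  Δ-degreeBelow r m B i m≤i with m≤n⇒m<n∨m≡n m≤i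
  ... | inj₁ m<i    = degreeBelow-⊖ (shift₁ r) r (shift₁-degreeBelow r B) B i m<i
  ... | inj₂ ≡.refl = trans (coeff-⊖ (shift₁ r) r i) (x≈y⇒x∙y⁻¹≈ε (shift₁-leading r m B))

  Δ-leading : ∀ r m → DegreeBelow r (2 ℕ.+ m) → coeff (Δ r) m ≈ ι (suc m) * coeff r (suc m)
  Δ-leading []      m       _ = sym (zeroʳ _)
  Δ-leading (a ∷ r) zero    B = begin
    coeff (Δ (a ∷ r)) 0  ≈⟨ coeff₀-Δ a r ⟩
    coeff (shift₁ r) 0   ≈⟨ shift₁-leading r 0 (degreeBelow-tail B) ⟩
    coeff r 0            ≈⟨ *-identityˡ _ ⟨
    1# * coeff r 0       ≈⟨ *-congʳ ι-1 ⟨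
    ι 1 * coeff r 0      ∎
  Δ-leading (a ∷ r) (suc m) B = begin
    coeff (Δ (a ∷ r)) (suc m)                           ≈⟨ coeffₛ-Δ a r m ⟩
    coeff (shift₁ r) (suc m) + coeff (Δ r) m            ≈⟨ +-cong (shift₁-leading r (suc m) (degreeBelow-tail B))
                                                                  (Δ-leading r m (degreeBelow-tail B)) ⟩
    coeff r (suc m) + ι (suc m) * coeff r (suc m)       ≈⟨ +-congʳ (*-identityˡ _) ⟨
    1# * coeff r (suc m) + ι (suc m) * coeff r (suc m)  ≈⟨ distribʳ _ _ _ ⟨
    ι (2 ℕ.+ m) * coeff r (suc m)                       ∎

  Δ-degreeBelow⁻¹ : ∀ r m → DegreeBelow (Δ r) m → DegreeBelow r (suc m)
  Δ-degreeBelow⁻¹ r m BΔ = degreeBelow-descend r top≈0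
    where
    top≈0 : ∀ n → suc m ≤ n → DegreeBelow r (suc n) → coeff r n ≈ 0#
    top≈0 (suc n) (s≤s m≤n) B = xy≈0⇒y≈0 (charZero n) (trans (sym (Δ-leading r n B)) (BΔ n m≤n))

  ΔX≋1 : Δ X ≋ const 1#
  ΔX≋1 zero    = trans (Δ-leading X 0 X-degreeBelow-2) (trans (*-identityʳ _) ι-1)
  ΔX≋1 (suc i) = Δ-degreeBelow X 1 X-degreeBelow-2 (suc i) (s≤s z≤n)

module DeltaOperator {c ℓ : Level} (𝕂 : CharZeroField c ℓ)
                     {Q : Polynomials.Op 𝕂} (δ : Polynomials.IsDelta 𝕂 Q) where
  open CharZeroField 𝕂
  open Polynomials 𝕂
  open FieldProperties field′
  open PolynomialProperties 𝕂
  open IsDelta δ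
  open IsLinear linear
  open Linear linear
  open import Algebra.Properties.Ring ring using (-0#≈0#; //-rightDividesˡ; x∙y⁻¹≈ε⇒x≈y; x≈y⇒x∙y⁻¹≈ε)
  open import Algebra.Properties.CommutativeSemigroup *-commutativeSemigroup using (x∙yz≈y∙xz)
  open import Relation.Binary.Reasoning.Setoid setoid

  Q-Δ-comm : ∀ r i → coeff (Q (Δ r)) i ≈ coeff (Δ (Q r)) i
  Q-Δ-comm r i = begin
    coeff (Q (Δ r)) i                       ≈⟨ linear-⊖ (shift₁ r) r i ⟩
    coeff (Q (shift₁ r)) i - coeff (Q r) i  ≈⟨ +-congʳ (shiftInv 1# r i) ⟩
    coeff (shift₁ (Q r)) i - coeff (Q r) i  ≈⟨ coeff-⊖ (shift₁ (Q r)) (Q r) i ⟨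
    coeff (Δ (Q r)) i                       ∎

  QX-degreeBelow-1 : DegreeBelow (Q X) 1
  QX-degreeBelow-1 (suc i) _ = QX≋const (suc i)

  Q1≋0 : DegreeBelow (Q (const 1#)) 0
  Q1≋0 i _ = begin
    coeff (Q (const 1#)) i  ≈⟨ respects (Δ X) (const 1#) ΔX≋1 i ⟨
    coeff (Q (Δ X)) i       ≈⟨ Q-Δ-comm X i ⟩
    coeff (Δ (Q X)) i       ≈⟨ Δ-degreeBelow (Q X) 0 QX-degreeBelow-1 i z≤n ⟩
    0#                      ∎

  Q-degreeBelow-1 : ∀ p → DegreeBelow p 1 → DegreeBelow (Q p) 0
  Q-degreeBelow-1 p B i _ = begin
    coeff (Q p) i                               ≈⟨ respects p _ (degreeBelow-1⇒≋scale-1 p B) i ⟩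
    coeff (Q (scale (coeff p 0) (const 1#))) i  ≈⟨ linear-scale (coeff p 0) (const 1#) i ⟩
    coeff p 0 * coeff (Q (const 1#)) i          ≈⟨ *-congˡ (Q1≋0 i z≤n) ⟩
    coeff p 0 * 0#                              ≈⟨ zeroʳ _ ⟩
    0#                                          ∎

  Q-degreeBelow : ∀ r m → DegreeBelow r (suc m) → DegreeBelow (Q r) m
  Q-degreeBelow r zero    B = Q-degreeBelow-1 r B
  Q-degreeBelow r (suc m) B = Δ-degreeBelow⁻¹ (Q r) m QΔr-degreeBelow
    where
    QΔr-degreeBelow : DegreeBelow (Δ (Q r)) m
    QΔr-degreeBelow i m≤i =
      trans (sym (Q-Δ-comm r i)) (Q-degreeBelow (Δ r) m (Δ-degreeBelow r (suc m) B) i m≤i)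

  Q-leading : ∀ r m → DegreeBelow r (2 ℕ.+ m) → coeff (Q r) m ≈ constX * (ι (suc m) * coeff r (suc m))
  Q-leading r zero B = begin
    coeff (Q r) 0
      ≈⟨ respects r _ (degreeBelow-2⇒≋affine r B) 0 ⟩
    coeff (Q (const (coeff r 0) ⊕ scale (coeff r 1) X)) 0
      ≈⟨ linear-⊕ (const (coeff r 0)) (scale (coeff r 1) X) 0 ⟩
    coeff (Q (const (coeff r 0))) 0 + coeff (Q (scale (coeff r 1) X)) 0
      ≈⟨ +-cong (Q-degreeBelow-1 _ (const-degreeBelow-1 _) 0 z≤n) (linear-scale (coeff r 1) X 0) ⟩
    0# + coeff r 1 * coeff (Q X) 0
      ≈⟨ +-identityˡ _ ⟩
    coeff r 1 * coeff (Q X) 0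
      ≈⟨ *-congˡ (QX≋const 0) ⟩
    coeff r 1 * constX
      ≈⟨ *-comm _ _ ⟩
    constX * coeff r 1
      ≈⟨ *-congˡ (trans (*-congʳ ι-1) (*-identityˡ _)) ⟨
    constX * (ι 1 * coeff r 1)
      ∎
  Q-leading r (suc m) B = *-cancelˡ (charZero m) (begin
    ι (suc m) * coeff (Q r) (suc m)
      ≈⟨ Δ-leading (Q r) m (Q-degreeBelow r (2 ℕ.+ m) B) ⟨
    coeff (Δ (Q r)) m
      ≈⟨ Q-Δ-comm r m ⟨
    coeff (Q (Δ r)) m
      ≈⟨ Q-leading (Δ r) m (Δ-degreeBelow r (2 ℕ.+ m) B) ⟩
    constX * (ι (suc m) * coeff (Δ r) (suc m))
      ≈⟨ *-congˡ (*-congˡ (Δ-leading r (suc m) B)) ⟩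
    constX * (ι (suc m) * (ι (2 ℕ.+ m) * coeff r (2 ℕ.+ m)))
      ≈⟨ x∙yz≈y∙xz _ _ _ ⟩
    ι (suc m) * (constX * (ι (2 ℕ.+ m) * coeff r (2 ℕ.+ m)))
      ∎)

  Q-degreeBelow⁻¹ : ∀ r m → DegreeBelow (Q r) m → DegreeBelow r (suc m)
  Q-degreeBelow⁻¹ r m BQ = degreeBelow-descend r top≈0
    where
    top≈0 : ∀ n → suc m ≤ n → DegreeBelow r (suc n) → coeff r n ≈ 0#
    top≈0 (suc n) (s≤s m≤n) B =
      xy≈0⇒y≈0 (charZero n) (xy≈0⇒y≈0 constX≉0 (trans (sym (Q-leading r n B)) (BQ n m≤n)))

  Q-cancel : ∀ u v → Q u ≋ Q v → coeff u 0 ≈ coeff v 0 → u ≋ v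
  Q-cancel u v Qu≋Qv u₀≈v₀ zero    = u₀≈v₀
  Q-cancel u v Qu≋Qv u₀≈v₀ (suc i) =
    x∙y⁻¹≈ε⇒x≈y _ _ (trans (sym (coeff-⊖ u v (suc i))) (u-v-degreeBelow-1 (suc i) (s≤s z≤n)))
    where
    u-v-degreeBelow-1 : DegreeBelow (u ⊖ v) 1
    u-v-degreeBelow-1 = Q-degreeBelow⁻¹ (u ⊖ v) 0 (λ j _ → trans (linear-⊖ u v j) (x≈y⇒x∙y⁻¹≈ε (Qu≋Qv j)))

  Q-1-ℰ : ∀ p → Q (1-ℰ p) ≋ Q p
  Q-1-ℰ p i = begin
    coeff (Q (1-ℰ p)) i                  ≈⟨ linear-⊖ p (ℰ p) i ⟩
    coeff (Q p) i - coeff (Q (ℰ p)) i    ≈⟨ +-congˡ (-‿cong Qℰp≈0) ⟩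
    coeff (Q p) i - 0#                   ≈⟨ +-congˡ -0#≈0# ⟩
    coeff (Q p) i + 0#                   ≈⟨ +-identityʳ _ ⟩
    coeff (Q p) i                        ∎
    where
    Qℰp≈0 : coeff (Q (ℰ p)) i ≈ 0#
    Qℰp≈0 = Q-degreeBelow-1 (ℰ p) (const-degreeBelow-1 (eval p 0#)) i z≤n

  leadingPreimage : ℕ → Poly → Poly
  leadingPreimage n p = monomial (inv (ι (suc n)) (charZero n) * (inv constX constX≉0 * coeff p n)) (suc n)

  Q-leadingPreimage : ∀ n p → coeff (Q (leadingPreimage n p)) n ≈ coeff p n
  Q-leadingPreimage n p = begin
    coeff (Q (leadingPreimage n p)) n
      ≈⟨ Q-leading (leadingPreimage n p) n (monomial-degreeBelow _ (suc n)) ⟩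
    constX * (ι (suc n) * coeff (leadingPreimage n p) (suc n))
      ≈⟨ *-congˡ (*-congˡ (coeff-monomial _ (suc n))) ⟩
    constX * (ι (suc n) * (inv (ι (suc n)) (charZero n) * (inv constX constX≉0 * coeff p n)))
      ≈⟨ *-congˡ (*-inv-cancel (ι (suc n)) (charZero n) _) ⟩
    constX * (inv constX constX≉0 * coeff p n)
      ≈⟨ *-inv-cancel constX constX≉0 _ ⟩
    coeff p n
      ∎

  preimage : ℕ → Poly → Poly
  preimage zero    p = zeroP
  preimage (suc n) p = preimage n (p ⊖ Q (leadingPreimage n p)) ⊕ leadingPreimage n p

  Q-preimage : ∀ n p → DegreeBelow p n → Q (preimage n p) ≋ p
  Q-preimage zero    p B i = trans (linear-zeroP i z≤n) (sym (B i z≤n))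
  Q-preimage (suc n) p B i = begin
    coeff (Q (preimage n p′ ⊕ m)) i              ≈⟨ linear-⊕ (preimage n p′) m i ⟩
    coeff (Q (preimage n p′)) i + coeff (Q m) i  ≈⟨ +-congʳ (Q-preimage n p′ p′-degreeBelow i) ⟩
    coeff p′ i + coeff (Q m) i                   ≈⟨ +-congʳ (coeff-⊖ p (Q m) i) ⟩
    coeff p i - coeff (Q m) i + coeff (Q m) i    ≈⟨ //-rightDividesˡ _ _ ⟩
    coeff p i                                    ∎
    where
    m p′ : Poly
    m  = leadingPreimage n p
    p′ = p ⊖ Q m
    p′-degreeBelow : DegreeBelow p′ n
    p′-degreeBelow =
      degreeBelow-lower p′ (degreeBelow-⊖ p (Q m) B (Q-degreeBelow m (suc n) (monomial-degreeBelow _ (suc n))))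
                           (trans (coeff-⊖ p (Q m) n) (x≈y⇒x∙y⁻¹≈ε (sym (Q-leadingPreimage n p))))

  Qinv : Op
  Qinv p = 1-ℰ (preimage (length p) p)

  Q∘Qinv≐id : (Q ∘ₒ Qinv) ≐ idOp
  Q∘Qinv≐id p i = trans (Q-1-ℰ (preimage (length p) p) i) (Q-preimage (length p) p (degreeBelow-length p) i)

  coeff₀-Qinv : ∀ p → coeff (Qinv p) 0 ≈ 0#
  coeff₀-Qinv p = coeff₀-1-ℰ (preimage (length p) p)

  Qinv-unique : ∀ u p → Q u ≋ p → coeff u 0 ≈ 0# → Qinv p ≋ u
  Qinv-unique u p Qu≋p u₀≈0 =
    Q-cancel (Qinv p) u (λ i → trans (Q∘Qinv≐id p i) (sym (Qu≋p i))) (trans (coeff₀-Qinv p) (sym u₀≈0))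

  Qinv-linear : IsLinear Qinv
  Qinv-linear = record { respects = Qinv-respects ; additive = Qinv-additive ; homog = Qinv-homog }
    where
    Qinv-respects : ∀ p q → p ≋ q → Qinv p ≋ Qinv q
    Qinv-respects p q p≋q = Qinv-unique (Qinv q) p (λ i → trans (Q∘Qinv≐id q i) (sym (p≋q i))) (coeff₀-Qinv q)

    Qinv-additive : ∀ p q → Qinv (p ⊕ q) ≋ Qinv p ⊕ Qinv q
    Qinv-additive p q = Qinv-unique (Qinv p ⊕ Qinv q) (p ⊕ q) Q-sum sum₀≈0
      where
      Q-sum : Q (Qinv p ⊕ Qinv q) ≋ p ⊕ q
      Q-sum i = begin
        coeff (Q (Qinv p ⊕ Qinv q)) i                ≈⟨ linear-⊕ (Qinv p) (Qinv q) i ⟩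
        coeff (Q (Qinv p)) i + coeff (Q (Qinv q)) i  ≈⟨ +-cong (Q∘Qinv≐id p i) (Q∘Qinv≐id q i) ⟩
        coeff p i + coeff q i                        ≈⟨ coeff-⊕ p q i ⟨
        coeff (p ⊕ q) i                              ∎
      sum₀≈0 : coeff (Qinv p ⊕ Qinv q) 0 ≈ 0#
      sum₀≈0 = begin
        coeff (Qinv p ⊕ Qinv q) 0                ≈⟨ coeff-⊕ (Qinv p) (Qinv q) 0 ⟩
        coeff (Qinv p) 0 + coeff (Qinv q) 0      ≈⟨ +-cong (coeff₀-Qinv p) (coeff₀-Qinv q) ⟩
        0# + 0#                                  ≈⟨ +-identityʳ 0# ⟩
        0#                                       ∎

    Qinv-homog : ∀ a p → Qinv (scale a p) ≋ scale a (Qinv p)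
    Qinv-homog a p = Qinv-unique (scale a (Qinv p)) (scale a p) Q-scaled scaled₀≈0
      where
      Q-scaled : Q (scale a (Qinv p)) ≋ scale a p
      Q-scaled i = begin
        coeff (Q (scale a (Qinv p))) i  ≈⟨ linear-scale a (Qinv p) i ⟩
        a * coeff (Q (Qinv p)) i        ≈⟨ *-congˡ (Q∘Qinv≐id p i) ⟩
        a * coeff p i                   ≈⟨ coeff-scale a p i ⟨
        coeff (scale a p) i             ∎
      scaled₀≈0 : coeff (scale a (Qinv p)) 0 ≈ 0#
      scaled₀≈0 = trans (coeff-scale a (Qinv p) 0) (trans (*-congˡ (coeff₀-Qinv p)) (zeroʳ a))

  Qinv∘Q≐1-ℰ : (Qinv ∘ₒ Q) ≐ 1-ℰ
  Qinv∘Q≐1-ℰ p = Qinv-unique (1-ℰ p) (Q p) (Q-1-ℰ p) (coeff₀-1-ℰ p)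

  Qinv-unique-operator : (R : Op) → IsLinear R → (Q ∘ₒ R) ≐ idOp → (R ∘ₒ Q) ≐ 1-ℰ → R ≐ Qinv
  Qinv-unique-operator R R-linear Q∘R≐id R∘Q≐1-ℰ p i = sym (Qinv-unique (R p) p (Q∘R≐id p) Rp₀≈0 i)
    where
    Rp₀≈0 : coeff (R p) 0 ≈ 0#
    Rp₀≈0 = begin
      coeff (R p) 0             ≈⟨ IsLinear.respects R-linear (Q (Qinv p)) p (Q∘Qinv≐id p) 0 ⟨
      coeff (R (Q (Qinv p))) 0  ≈⟨ R∘Q≐1-ℰ (Qinv p) 0 ⟩
      coeff (1-ℰ (Qinv p)) 0    ≈⟨ coeff₀-1-ℰ (Qinv p) ⟩
      0#                        ∎

  Qinv-sheffer : (s : ℕ → Poly) → IsSheffer Q s → (n : ℕ) →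
                 Qinv (s n) ≋ scale (inv (ι (suc n)) (charZero n)) (1-ℰ (s (suc n)))
  Qinv-sheffer s s-sheffer n = Qinv-unique (scale k (1-ℰ (s (suc n)))) (s n) Q-image image₀≈0
    where
    k : Carrier
    k = inv (ι (suc n)) (charZero n)
    Q-image : Q (scale k (1-ℰ (s (suc n)))) ≋ s n
    Q-image i = begin
      coeff (Q (scale k (1-ℰ (s (suc n))))) i  ≈⟨ linear-scale k (1-ℰ (s (suc n))) i ⟩
      k * coeff (Q (1-ℰ (s (suc n)))) i        ≈⟨ *-congˡ (Q-1-ℰ (s (suc n)) i) ⟩
      k * coeff (Q (s (suc n))) i              ≈⟨ *-congˡ (IsSheffer.Q-ssuc s-sheffer n i) ⟩
      k * coeff (scale (ι (suc n)) (s n)) i    ≈⟨ *-congˡ (coeff-scale (ι (suc n)) (s n) i) ⟩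
      k * (ι (suc n) * coeff (s n) i)          ≈⟨ inv-*-cancel (ι (suc n)) (charZero n) _ ⟩
      coeff (s n) i                            ∎
    image₀≈0 : coeff (scale k (1-ℰ (s (suc n)))) 0 ≈ 0#
    image₀≈0 = trans (coeff-scale k (1-ℰ (s (suc n))) 0) (trans (*-congˡ (coeff₀-1-ℰ (s (suc n)))) (zeroʳ k))

mainTheorem9 : {c ℓ : Level} (𝕂 : CharZeroField c ℓ) →
    let open CharZeroField 𝕂
        open Polynomials 𝕂 in
    (Q : Op) → IsDelta Q →
    Σ Op (λ Qinv →
      IsLinear Qinv
      × (Q ∘ₒ Qinv) ≐ idOp
      × (Qinv ∘ₒ Q) ≐ 1-ℰ
      × ((R : Op) → IsLinear R → (Q ∘ₒ R) ≐ idOp → (R ∘ₒ Q) ≐ 1-ℰ → R ≐ Qinv)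
      × ((s : ℕ → Poly) → IsSheffer Q s → (n : ℕ) →
           Qinv (s n) ≋ scale (inv (ι (suc n)) (charZero n))
                              (s (suc n) ⊖ const (eval (s (suc n)) 0#))))
mainTheorem9 𝕂 Q δ = Qinv , Qinv-linear , Q∘Qinv≐id , Qinv∘Q≐1-ℰ , Qinv-unique-operator , Qinv-sheffer
  where open DeltaOperator 𝕂 δ
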